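{- Let $n \ge 1$ and let $A[1..n]$ be an array of pairwise distinct elements from a totally ordered set. Run the following procedure: for $i = 1, \ldots, n$, for $j = 1, \ldots, n$, if $A[i] < A[j]$ then swap $A[i]$ and $A[j]$. Call the iterations with $i = 1$ the selection phase and the iterations with $i = 2, \ldots, n$ the insertion phase. Then each swap performed during the selection phase increases the number of inversions of the array by exactly one, and each swap performed during the insertion phase decreases the number of inversions of the array by exactly one.
   Context: An inversion of an array $A[1..n]$ is a pair of indices $(p,q)$ with $p<q$ and $A[p] > A[q]$. The loops are nested in the standard way (the full inner loop over $j$ runs for each value of $i$ in increasing order), and each comparison uses the current array contents. The number of inversions is measured on the array contents immediately before and immediately after the swap. -}

module Defs where

open import Level using (Level)
open import Data.Nat using (ℕ; suc)
open import Data.Nat.Properties using () renaming (_<?_ to _<ℕ?_)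
open import Data.Fin using (Fin; toℕ) renaming (_≟_ to _≟F_)
open import Data.List using (List; []; _∷_; length; filter; map; concatMap; allFin)
open import Data.Product using (_×_; _,_)
open import Relation.Nullary using (yes; no)
open import Relation.Nullary.Decidable using (_×-dec_)
open import Relation.Binary.Bundles using (StrictTotalOrder)
import Relation.Binary.PropositionalEquality

module _ {a ℓ₁ ℓ₂ : Level} (O : StrictTotalOrder a ℓ₁ ℓ₂) where
  open StrictTotalOrder O using (_≈_; _<_; _<?_) renaming (Carrier to X)

  -- An array A[1..n], indexed 0-based by Fin n.
  Array : ℕ → Set a
  Array n = Fin n → X

  swapAt : ∀ {n} → Array n → Fin n → Fin n → Array n
  swapAt A i j k with k ≟F i
  ... | yes _ = A j
  ... | no _ with k ≟F j
  ...   | yes _ = A i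
  ...   | no _  = A k

  step : ∀ {n} → Array n → Fin n × Fin n → Array n
  step A (i , j) with A i <? A j
  ... | yes _ = swapAt A i j
  ... | no _  = A

  run : ∀ {n} → List (Fin n × Fin n) → Array n → Array n
  run []       A = A
  run (p ∷ ps) A = run ps (step A p)

  inversions : ∀ {n} → Array n → ℕ
  inversions {n} A =
    length (filter (λ { (p , q) → (toℕ p <ℕ? toℕ q) ×-dec (A q <? A p) })
                   (concatMap (λ p → map (p ,_) (allFin n)) (allFin n)))

  Distinct : ∀ {n} → Array n → Set ℓ₁
  Distinct {n} A = ∀ (p q : Fin n) → A p ≈ A q → p Relation.Binary.PropositionalEquality.≡ q

schedule : (n : ℕ) → List (Fin n × Fin n)
schedule n = concatMap (λ i → map (i ,_) (allFin n)) (allFin n)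

-- Exchanging the entries at positions i and j, where A[i] < A[j], only affects the pairs that
-- contain i or j. If no entry strictly between the two positions has a value strictly between
-- A[i] and A[j], then for every other position k the pairs {i, k} and {j, k} together contain
-- as many inversions before the exchange as after it, so the count changes by the pair {i, j}
-- alone: it goes up by one if i < j and down by one if j < i.
--
-- Every swap of the procedure meets this condition. In the selection phase A[1] is the largest
-- of the entries scanned so far, so everything between position 1 and j is smaller than A[1],
-- and j > 1. In the insertion phase for i ≥ 2 the prefix A[1..i-1] is sorted and its last
-- entry is the maximum of the array; the scan over j < i inserts A[i] into the prefix and
-- moves the maximum to position i, after which nothing is swapped. So swaps happen only at
-- j < i, and the sorted prefix puts every entry between positions j and i above A[j].
module Submission where

open import Defs
open import Level using (Level; _⊔_)
open import Data.Bool using (true; false; if_then_else_)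
open import Data.Nat using (ℕ; zero; suc; _+_; _*_; _<_; _≤_; _<?_; z≤n; s≤s)
open import Data.Nat.Properties
  using ( +-0-commutativeMonoid; +-commutativeSemigroup; +-assoc; +-comm; +-identityʳ; +-suc
        ; <-irrefl; <-asym; <-trans; <-≤-trans; <-cmp; ≤-trans; ≤-antisym; <⇒≤; <⇒≱; ≮⇒≥
        ; m<1+n⇒m≤n; n≮0; n≤1+n; n<1+n; suc-injective )
open import Data.Nat.Tactic.RingSolver using (solve-∀)
open import Data.Fin using (Fin; zero; suc; toℕ; _≟_)
import Data.Fin.Properties as Fin
open import Data.Fin.Permutation as Perm using ()
open import Data.Fin.Permutation.Components using (transpose; transpose-inverse)
open import Data.List using (List; []; _∷_; _++_; length; filter; concat; concatMap; map; tabulate; allFin)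
open import Data.List.Properties using (filter-++; length-++; map-tabulate)
open import Data.Product using (_×_; _,_; proj₁; proj₂)
open import Data.Sum using (_⊎_; inj₁; inj₂)
open import Data.Unit.Polymorphic using (⊤; tt)
open import Function using (_∘_)
open import Relation.Nullary using (¬_; Dec; yes; no; does; contradiction)
open import Relation.Nullary.Decidable using (dec-true; dec-false; _×-dec_)
open import Relation.Unary using (Pred; Decidable)
open import Relation.Binary using (tri<; tri≈; tri>)
open import Relation.Binary.Bundles using (StrictTotalOrder)
open import Relation.Binary.PropositionalEquality
open import Algebra.Properties.CommutativeSemigroup +-commutativeSemigroup using (x∙yz≈y∙xz)
open import Algebra.Properties.CommutativeMonoid.Sum +-0-commutativeMonoid
  using (sum; sum-cong-≗; ∑-distrib-+; sum-permute)

𝟙[_] : ∀ {p} {P : Set p} → Dec P → ℕ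
𝟙[ d ] = if does d then 1 else 0

𝟙-yes : ∀ {p} {P : Set p} (d : Dec P) → P → 𝟙[ d ] ≡ 1
𝟙-yes (yes _) _  = refl
𝟙-yes (no ¬p) p = contradiction p ¬p

𝟙-no : ∀ {p} {P : Set p} (d : Dec P) → ¬ P → 𝟙[ d ] ≡ 0
𝟙-no (yes p) ¬p = contradiction p ¬p
𝟙-no (no _)  _  = refl

𝟙-× : ∀ {p q} {P : Set p} {Q : Set q} (d : Dec P) (e : Dec Q) → 𝟙[ d ×-dec e ] ≡ 𝟙[ d ] * 𝟙[ e ]
𝟙-× (yes _) (yes _) = refl
𝟙-× (yes _) (no _)  = refl
𝟙-× (no _)  _       = refl

module _ {a p : Level} {A : Set a} {P : Pred A p} (P? : Decidable P) where

  length-filter-∷ : ∀ x xs → length (filter P? (x ∷ xs)) ≡ 𝟙[ P? x ] + length (filter P? xs)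
  length-filter-∷ x xs with does (P? x)
  ... | true  = refl
  ... | false = refl

  length-filter-tabulate : ∀ {m} (g : Fin m → A) → length (filter P? (tabulate g)) ≡ sum (λ k → 𝟙[ P? (g k) ])
  length-filter-tabulate {zero}  g = refl
  length-filter-tabulate {suc m} g =
    trans (length-filter-∷ (g zero) _) (cong (𝟙[ P? (g zero) ] +_) (length-filter-tabulate (g ∘ suc)))

  length-filter-concat-tabulate : ∀ {m} (g : Fin m → List A) →
    length (filter P? (concat (tabulate g))) ≡ sum (λ k → length (filter P? (g k)))
  length-filter-concat-tabulate {zero}  g = refl
  length-filter-concat-tabulate {suc m} g = begin
    length (filter P? (g zero ++ concat (tabulate (g ∘ suc))))
      ≡⟨ cong length (filter-++ P? (g zero) _) ⟩
    length (filter P? (g zero) ++ filter P? (concat (tabulate (g ∘ suc))))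
      ≡⟨ length-++ (filter P? (g zero)) ⟩
    length (filter P? (g zero)) + length (filter P? (concat (tabulate (g ∘ suc))))
      ≡⟨ cong (length (filter P? (g zero)) +_) (length-filter-concat-tabulate (g ∘ suc)) ⟩
    sum (λ k → length (filter P? (g k))) ∎
    where open ≡-Reasoning

∑² : ∀ {n} → (Fin n → Fin n → ℕ) → ℕ
∑² H = sum (λ p → sum (H p))

except : ∀ {n} → Fin n → (Fin n → ℕ) → Fin n → ℕ
except i f k = if does (k ≟ i) then 0 else f k

except-≢ : ∀ {n} {i k : Fin n} (f : Fin n → ℕ) → k ≢ i → except i f k ≡ f k
except-≢ {i = i} {k} f k≢i rewrite dec-false (k ≟ i) k≢i = refl

sum-except : ∀ {n} (f : Fin n → ℕ) i → sum f ≡ f i + sum (except i f)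
sum-except {suc n} f zero    = refl
sum-except {suc n} f (suc i) = begin
  f zero + sum (f ∘ suc)                               ≡⟨ cong (f zero +_) (sum-except (f ∘ suc) i) ⟩
  f zero + (f (suc i) + sum (except i (f ∘ suc)))      ≡⟨ x∙yz≈y∙xz (f zero) (f (suc i)) _ ⟩
  f (suc i) + (f zero + sum (except i (f ∘ suc)))      ∎
  where open ≡-Reasoning

module TwoPoints {n} (i j : Fin n) (j≢i : j ≢ i) where

  without : (Fin n → ℕ) → Fin n → ℕ
  without f = except j (except i f)

  sum-without : ∀ f → sum f ≡ f i + f j + sum (without f)
  sum-without f = begin
    sum f                                      ≡⟨ sum-except f i ⟩
    f i + sum (except i f)                     ≡⟨ cong (f i +_) (sum-except (except i f) j) ⟩
    f i + (except i f j + sum (without f))     ≡⟨ cong (λ x → f i + (x + sum (without f))) (except-≢ f j≢i) ⟩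
    f i + (f j + sum (without f))              ≡⟨ +-assoc (f i) (f j) _ ⟨
    f i + f j + sum (without f)                ∎
    where open ≡-Reasoning

  sum-without-cong : ∀ {f g} → (∀ k → k ≢ i → k ≢ j → f k ≡ g k) → sum (without f) ≡ sum (without g)
  sum-without-cong {f} {g} f≡g = sum-cong-≗ without-≗
    where
    without-≗ : ∀ k → without f k ≡ without g k
    without-≗ k with k ≟ j | k ≟ i
    ... | yes _   | _       = refl
    ... | no _    | yes _   = refl
    ... | no k≢j  | no k≢i  = f≡g k k≢i k≢j

  sum-without-+ : ∀ f g → sum (without (λ k → f k + g k)) ≡ sum (without f) + sum (without g)
  sum-without-+ f g = trans (sum-cong-≗ without-+) (∑-distrib-+ (without f) (without g))
    where
    without-+ : ∀ k → without (λ k → f k + g k) k ≡ without f k + without g k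
    without-+ k with does (k ≟ j) | does (k ≟ i)
    ... | true  | _     = refl
    ... | false | true  = refl
    ... | false | false = refl

  corner : (Fin n → Fin n → ℕ) → ℕ
  corner H = H i i + H i j + H j i + H j j

  cross : (Fin n → Fin n → ℕ) → Fin n → ℕ
  cross H k = H i k + H j k + (H k i + H k j)

  interior : (Fin n → Fin n → ℕ) → ℕ
  interior H = sum (without (λ p → sum (without (H p))))

  ∑²-split : ∀ H → ∑² H ≡ corner H + sum (without (cross H)) + interior H
  ∑²-split H = begin
    ∑² H
      ≡⟨ sum-without (λ p → sum (H p)) ⟩
    sum (H i) + sum (H j) + sum (without (λ p → sum (H p)))
      ≡⟨ cong₂ (λ x y → x + y + sum (without (λ p → sum (H p)))) (sum-without (H i)) (sum-without (H j)) ⟩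
    (H i i + H i j + Sᵢ) + (H j i + H j j + Sⱼ) + sum (without (λ p → sum (H p)))
      ≡⟨ cong ((H i i + H i j + Sᵢ) + (H j i + H j j + Sⱼ) +_) columns ⟩
    (H i i + H i j + Sᵢ) + (H j i + H j j + Sⱼ) + (sum (without column) + interior H)
      ≡⟨ shuffle (H i i) (H i j) (H j i) (H j j) Sᵢ Sⱼ (sum (without column)) (interior H) ⟩
    corner H + (Sᵢ + Sⱼ + sum (without column)) + interior H
      ≡⟨ cong (λ x → corner H + x + interior H) crosses ⟨
    corner H + sum (without (cross H)) + interior H ∎
    where
    open ≡-Reasoning
    Sᵢ = sum (without (H i))
    Sⱼ = sum (without (H j))
    column : Fin n → ℕ
    column p = H p i + H p j
    columns : sum (without (λ p → sum (H p))) ≡ sum (without column) + interior H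
    columns = trans (sum-without-cong (λ p _ _ → sum-without (H p)))
                    (sum-without-+ column (λ p → sum (without (H p))))
    crosses : sum (without (cross H)) ≡ Sᵢ + Sⱼ + sum (without column)
    crosses = trans (sum-without-+ (λ k → H i k + H j k) column)
                    (cong (_+ sum (without column)) (sum-without-+ (H i) (H j)))
    shuffle : ∀ a b c d s t u v → (a + b + s) + (c + d + t) + (u + v) ≡ (a + b + c + d) + (s + t + u) + v
    shuffle = solve-∀

  ∑²-corner-cong : ∀ {H H′} →
    (∀ p q → p ≢ i → p ≢ j → q ≢ i → q ≢ j → H p q ≡ H′ p q) →
    (∀ k → k ≢ i → k ≢ j → cross H k ≡ cross H′ k) →
    ∑² H + corner H′ ≡ ∑² H′ + corner H
  ∑²-corner-cong {H} {H′} interior≡ cross≡ = begin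
    ∑² H + corner H′
      ≡⟨ cong (_+ corner H′) (∑²-split H) ⟩
    corner H + sum (without (cross H)) + interior H + corner H′
      ≡⟨ cong₂ (λ x y → corner H + x + y + corner H′) (sum-without-cong cross≡) interiors ⟩
    corner H + sum (without (cross H′)) + interior H′ + corner H′
      ≡⟨ swap-ends (corner H) (sum (without (cross H′))) (interior H′) (corner H′) ⟩
    corner H′ + sum (without (cross H′)) + interior H′ + corner H
      ≡⟨ cong (_+ corner H) (∑²-split H′) ⟨
    ∑² H′ + corner H ∎
    where
    open ≡-Reasoning
    interiors : interior H ≡ interior H′
    interiors = sum-without-cong (λ p p≢i p≢j →
                  sum-without-cong (λ q q≢i q≢j → interior≡ p q p≢i p≢j q≢i q≢j))
    swap-ends : ∀ a b c d → a + b + c + d ≡ d + b + c + a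
    swap-ends = solve-∀

StrictlyBetween : ℕ → ℕ → ℕ → Set
StrictlyBetween a c b = (a < c × c < b) ⊎ (b < c × c < a)

between-or-same-side : ∀ {a b c} → c ≢ a → c ≢ b →
  StrictlyBetween a c b ⊎ (𝟙[ a <? c ] ≡ 𝟙[ b <? c ] × 𝟙[ c <? a ] ≡ 𝟙[ c <? b ])
between-or-same-side {a} {b} {c} c≢a c≢b with <-cmp c a | <-cmp c b
... | tri≈ _ c≡a _ | _            = contradiction c≡a c≢a
... | _            | tri≈ _ c≡b _ = contradiction c≡b c≢b
... | tri< c<a _ _ | tri< c<b _ _ =
  inj₂ (trans (𝟙-no (a <? c) (<-asym c<a)) (sym (𝟙-no (b <? c) (<-asym c<b))) ,
        trans (𝟙-yes (c <? a) c<a) (sym (𝟙-yes (c <? b) c<b)))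
... | tri> _ _ a<c | tri> _ _ b<c =
  inj₂ (trans (𝟙-yes (a <? c) a<c) (sym (𝟙-yes (b <? c) b<c)) ,
        trans (𝟙-no (c <? a) (<-asym a<c)) (sym (𝟙-no (c <? b) (<-asym b<c))))
... | tri< c<a _ _ | tri> _ _ b<c = inj₁ (inj₂ (b<c , c<a))
... | tri> _ _ a<c | tri< c<b _ _ = inj₁ (inj₁ (a<c , c<b))

-- Position indicators x, y and value indicators u, v of the four pairs linking k to i and j:
-- exchanging the values of i and j permutes the products when either kind of indicator agrees.
cross-exchange : ∀ x₁ x₂ y₁ y₂ u v u′ v′ → (x₁ ≡ x₂ × y₁ ≡ y₂) ⊎ (u ≡ v × u′ ≡ v′) →
  x₂ * u + x₁ * v + (y₂ * u′ + y₁ * v′) ≡ x₁ * u + x₂ * v + (y₁ * u′ + y₂ * v′)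
cross-exchange x₁ .x₁ y₁ .y₁ u v u′ v′ (inj₁ (refl , refl)) = refl
cross-exchange x₁ x₂ y₁ y₂ u .u u′ .u′ (inj₂ (refl , refl)) =
  cong₂ _+_ (+-comm (x₂ * u) (x₁ * u)) (+-comm (y₂ * u′) (y₁ * u′))

transpose-matchˡ : ∀ {n} (i j : Fin n) → transpose i j i ≡ j
transpose-matchˡ i j rewrite dec-true (i ≟ i) refl = refl

transpose-matchʳ : ∀ {n} {i j : Fin n} → j ≢ i → transpose i j j ≡ i
transpose-matchʳ {i = i} {j} j≢i rewrite dec-false (j ≟ i) j≢i | dec-true (j ≟ j) refl = refl

transpose-other : ∀ {n} {i j k : Fin n} → k ≢ i → k ≢ j → transpose i j k ≡ k
transpose-other {i = i} {j} {k} k≢i k≢j rewrite dec-false (k ≟ i) k≢i | dec-false (k ≟ j) k≢j = refl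

transpose-injective : ∀ {n} (i j : Fin n) {p q} → transpose i j p ≡ transpose i j q → p ≡ q
transpose-injective i j {p} {q} eq =
  trans (sym (transpose-inverse j i)) (trans (cong (transpose j i) eq) (transpose-inverse j i))

<1+∧≢⇒< : ∀ {n} {k j : Fin n} → toℕ k < suc (toℕ j) → k ≢ j → toℕ k < toℕ j
<1+∧≢⇒< k<1+j k≢j = Fin.≤∧≢⇒< (m<1+n⇒m≤n k<1+j) k≢j

module _ {a ℓ₁ ℓ₂ : Level} (O : StrictTotalOrder a ℓ₁ ℓ₂) where
  open StrictTotalOrder O
    using (_≈_; compare; irrefl; asym; module Eq)
    renaming (_<_ to _≺_; _<?_ to _≺?_; trans to ≺-trans)

  ≮∧≉⇒≻ : ∀ {x y} → ¬ x ≺ y → ¬ x ≈ y → y ≺ x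
  ≮∧≉⇒≻ {x} {y} x⊀y x≉y with compare x y
  ... | tri< x≺y _ _ = contradiction x≺y x⊀y
  ... | tri≈ _ x≈y _ = contradiction x≈y x≉y
  ... | tri> _ _ y≺x = y≺x

  outside-alike : ∀ {x y z} → x ≺ y → z ≺ x ⊎ y ≺ z →
    𝟙[ z ≺? x ] ≡ 𝟙[ z ≺? y ] × 𝟙[ x ≺? z ] ≡ 𝟙[ y ≺? z ]
  outside-alike {x} {y} {z} x≺y (inj₁ z≺x) =
    trans (𝟙-yes (z ≺? x) z≺x) (sym (𝟙-yes (z ≺? y) (≺-trans z≺x x≺y))) ,
    trans (𝟙-no (x ≺? z) (asym z≺x)) (sym (𝟙-no (y ≺? z) (asym (≺-trans z≺x x≺y))))
  outside-alike {x} {y} {z} x≺y (inj₂ y≺z) =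
    trans (𝟙-no (z ≺? x) (asym (≺-trans x≺y y≺z))) (sym (𝟙-no (z ≺? y) (asym y≺z))) ,
    trans (𝟙-yes (x ≺? z) (≺-trans x≺y y≺z)) (sym (𝟙-yes (y ≺? z) y≺z))

  module _ {n : ℕ} where

    swapAt-transpose : ∀ (B : Array O n) i j k → swapAt O B i j k ≡ B (transpose i j k)
    swapAt-transpose B i j k with k ≟ i
    ... | yes _ = refl
    ... | no _ with k ≟ j
    ...   | yes _ = refl
    ...   | no _  = refl

    swapAt-atˡ : ∀ (B : Array O n) i j → swapAt O B i j i ≡ B j
    swapAt-atˡ B i j = trans (swapAt-transpose B i j i) (cong B (transpose-matchˡ i j))

    swapAt-atʳ : ∀ (B : Array O n) {i j} → j ≢ i → swapAt O B i j j ≡ B i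
    swapAt-atʳ B {i} {j} j≢i = trans (swapAt-transpose B i j j) (cong B (transpose-matchʳ j≢i))

    swapAt-other : ∀ (B : Array O n) {i j k} → k ≢ i → k ≢ j → swapAt O B i j k ≡ B k
    swapAt-other B {i} {j} {k} k≢i k≢j = trans (swapAt-transpose B i j k) (cong B (transpose-other k≢i k≢j))

    swapAt-distinct : ∀ {B : Array O n} i j → Distinct O B → Distinct O (swapAt O B i j)
    swapAt-distinct {B} i j distinct p q Bp≈Bq =
      transpose-injective i j
        (distinct _ _ (subst₂ _≈_ (swapAt-transpose B i j p) (swapAt-transpose B i j q) Bp≈Bq))

    step-distinct : ∀ {B : Array O n} x → Distinct O B → Distinct O (step O B x)
    step-distinct {B} (i , j) distinct with B i ≺? B j
    ... | yes _ = swapAt-distinct i j distinct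
    ... | no _  = distinct

    inversion-matrix : (Fin n → ℕ) → Array O n → Fin n → Fin n → ℕ
    inversion-matrix pos B p q = 𝟙[ pos p <? pos q ] * 𝟙[ B q ≺? B p ]

    inversions-∑² : ∀ (B : Array O n) → inversions O B ≡ ∑² (inversion-matrix toℕ B)
    inversions-∑² B = begin
      length (filter inverted? (concat (map row (allFin n))))
        ≡⟨ cong (λ rows → length (filter inverted? (concat rows))) (map-tabulate (λ p → p) row) ⟩
      length (filter inverted? (concat (tabulate row)))
        ≡⟨ length-filter-concat-tabulate inverted? row ⟩
      sum (λ p → length (filter inverted? (row p)))
        ≡⟨ sum-cong-≗ row-count ⟩
      ∑² (inversion-matrix toℕ B) ∎
      where
      open ≡-Reasoning
      inverted? : (x : Fin n × Fin n) → Dec (toℕ (proj₁ x) < toℕ (proj₂ x) × B (proj₂ x) ≺ B (proj₁ x))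
      inverted? (p , q) = (toℕ p <? toℕ q) ×-dec (B q ≺? B p)
      row : Fin n → List (Fin n × Fin n)
      row p = map (p ,_) (allFin n)
      row-count : ∀ p → length (filter inverted? (row p)) ≡ sum (inversion-matrix toℕ B p)
      row-count p = begin
        length (filter inverted? (row p))
          ≡⟨ cong (λ xs → length (filter inverted? xs)) (map-tabulate (λ q → q) (p ,_)) ⟩
        length (filter inverted? (tabulate (p ,_)))
          ≡⟨ length-filter-tabulate inverted? (p ,_) ⟩
        sum (λ q → 𝟙[ inverted? (p , q) ])
          ≡⟨ sum-cong-≗ (λ q → 𝟙-× (toℕ p <? toℕ q) (B q ≺? B p)) ⟩
        sum (inversion-matrix toℕ B p) ∎

    inversions-swapAt : ∀ (B : Array O n) {i j} → B i ≺ B j →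
      (∀ k → StrictlyBetween (toℕ i) (toℕ k) (toℕ j) → B k ≺ B i ⊎ B j ≺ B k) →
      inversions O (swapAt O B i j) + 𝟙[ toℕ j <? toℕ i ] ≡ inversions O B + 𝟙[ toℕ i <? toℕ j ]
    inversions-swapAt B {i} {j} Bi≺Bj gap = begin
      inversions O (swapAt O B i j) + 𝟙[ toℕ j <? toℕ i ] ≡⟨ cong₂ _+_ relabelled (sym (corner-value toℕ)) ⟩
      ∑² F + corner G                                     ≡⟨ ∑²-corner-cong interior≡ cross≡ ⟩
      ∑² G + corner F                                     ≡⟨ cong₂ _+_ (sym (inversions-∑² B)) corner-F ⟩
      inversions O B + 𝟙[ toℕ i <? toℕ j ]                ∎
      where
      open ≡-Reasoning
      j≢i : j ≢ i
      j≢i refl = irrefl Eq.refl Bi≺Bj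
      open TwoPoints i j j≢i

      τ : Fin n → Fin n
      τ = transpose j i
      τi : τ i ≡ j
      τi = transpose-matchʳ (j≢i ∘ sym)
      τj : τ j ≡ i
      τj = transpose-matchˡ j i
      τk : ∀ {k} → k ≢ i → k ≢ j → τ k ≡ k
      τk k≢i k≢j = transpose-other k≢j k≢i

      F G : Fin n → Fin n → ℕ
      F = inversion-matrix (toℕ ∘ τ) B
      G = inversion-matrix toℕ B

      relabelled : inversions O (swapAt O B i j) ≡ ∑² F
      relabelled = begin
        inversions O (swapAt O B i j)
          ≡⟨ inversions-∑² (swapAt O B i j) ⟩
        ∑² (inversion-matrix toℕ (swapAt O B i j))
          ≡⟨ sum-permute _ (Perm.transpose j i) ⟩
        sum (λ p → sum (inversion-matrix toℕ (swapAt O B i j) (τ p)))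
          ≡⟨ sum-cong-≗ (λ p → trans (sum-permute _ (Perm.transpose j i)) (sum-cong-≗ (entry p))) ⟩
        ∑² F ∎
        where
        unswap : ∀ k → swapAt O B i j (τ k) ≡ B k
        unswap k = trans (swapAt-transpose B i j (τ k)) (cong B (transpose-inverse i j))
        entry : ∀ p q → inversion-matrix toℕ (swapAt O B i j) (τ p) (τ q) ≡ F p q
        entry p q = cong₂ (λ x y → 𝟙[ toℕ (τ p) <? toℕ (τ q) ] * 𝟙[ x ≺? y ]) (unswap q) (unswap p)

      corner-value : ∀ pos → corner (inversion-matrix pos B) ≡ 𝟙[ pos j <? pos i ]
      corner-value pos = begin
        M i i + M i j + M j i + M j j
          ≡⟨ cong₂ _+_ (cong₂ _+_ (cong₂ _+_ (diagonal i) (cong (𝟙[ pos i <? pos j ] *_) Bj⊀Bi))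
                                  (cong (𝟙[ pos j <? pos i ] *_) (𝟙-yes (B i ≺? B j) Bi≺Bj)))
                       (diagonal j) ⟩
        0 + 𝟙[ pos i <? pos j ] * 0 + 𝟙[ pos j <? pos i ] * 1 + 0
          ≡⟨ simplify 𝟙[ pos i <? pos j ] 𝟙[ pos j <? pos i ] ⟩
        𝟙[ pos j <? pos i ] ∎
        where
        M = inversion-matrix pos B
        diagonal : ∀ k → M k k ≡ 0
        diagonal k = cong (_* 𝟙[ B k ≺? B k ]) (𝟙-no (pos k <? pos k) (<-irrefl refl))
        Bj⊀Bi : 𝟙[ B j ≺? B i ] ≡ 0
        Bj⊀Bi = 𝟙-no (B j ≺? B i) (asym Bi≺Bj)
        simplify : ∀ x y → 0 + x * 0 + y * 1 + 0 ≡ y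
        simplify = solve-∀

      corner-F : corner F ≡ 𝟙[ toℕ i <? toℕ j ]
      corner-F = trans (corner-value (toℕ ∘ τ)) (cong₂ (λ x y → 𝟙[ toℕ x <? toℕ y ]) τj τi)

      relabel : ∀ {p q p′ q′} → τ p ≡ p′ → τ q ≡ q′ → F p q ≡ 𝟙[ toℕ p′ <? toℕ q′ ] * 𝟙[ B q ≺? B p ]
      relabel refl refl = refl

      interior≡ : ∀ p q → p ≢ i → p ≢ j → q ≢ i → q ≢ j → F p q ≡ G p q
      interior≡ p q p≢i p≢j q≢i q≢j = relabel (τk p≢i p≢j) (τk q≢i q≢j)

      cross≡ : ∀ k → k ≢ i → k ≢ j → cross F k ≡ cross G k
      cross≡ k k≢i k≢j =
        trans (cong₂ _+_ (cong₂ _+_ (relabel τi τk′) (relabel τj τk′))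
                         (cong₂ _+_ (relabel τk′ τi) (relabel τk′ τj)))
              (cross-exchange _ _ _ _ _ _ _ _ alike)
        where
        τk′ = τk k≢i k≢j
        alike : (𝟙[ toℕ i <? toℕ k ] ≡ 𝟙[ toℕ j <? toℕ k ] × 𝟙[ toℕ k <? toℕ i ] ≡ 𝟙[ toℕ k <? toℕ j ])
              ⊎ (𝟙[ B k ≺? B i ] ≡ 𝟙[ B k ≺? B j ] × 𝟙[ B i ≺? B k ] ≡ 𝟙[ B j ≺? B k ])
        alike with between-or-same-side (k≢i ∘ Fin.toℕ-injective) (k≢j ∘ Fin.toℕ-injective)
        ... | inj₁ between = inj₂ (outside-alike Bi≺Bj (gap k between))
        ... | inj₂ alike   = inj₁ alike

    IsMaxAt : Array O n → Fin n → Set ℓ₂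
    IsMaxAt B p = ∀ m → m ≢ p → B m ≺ B p

    IsMaxAt-swapAt : ∀ {B : Array O n} {i j p} → IsMaxAt B (transpose i j p) → IsMaxAt (swapAt O B i j) p
    IsMaxAt-swapAt {B} {i} {j} {p} max m m≢p =
      subst₂ _≺_ (sym (swapAt-transpose B i j m)) (sym (swapAt-transpose B i j p))
        (max (transpose i j m) (m≢p ∘ transpose-injective i j))

    IsMaxAt⇒⊀ : ∀ {B : Array O n} {i} → IsMaxAt B i → ∀ k → ¬ B i ≺ B k
    IsMaxAt⇒⊀ {i = i} max k with k ≟ i
    ... | yes refl = irrefl Eq.refl
    ... | no k≢i   = asym (max k k≢i)

    -- The state of row i > 0 after its comparisons with columns 0, …, J - 1 (positions are 0-based).
    record Inserting (B : Array O n) (i : Fin n) (J : ℕ) : Set ℓ₂ where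
      field
        sorted    : ∀ p q → toℕ p < toℕ q → toℕ q < toℕ i → B p ≺ B q
        max-left  : J < toℕ i → ∀ p → suc (toℕ p) ≡ toℕ i → IsMaxAt B p
        max-here  : toℕ i ≤ J → IsMaxAt B i
        dominates : ∀ k → toℕ k < J → toℕ k < toℕ i → B k ≺ B i

    inserting-late : ∀ {B i j} → toℕ i ≤ toℕ j → Inserting B i (toℕ j) →
      Inserting (step O B (i , j)) i (suc (toℕ j))
    inserting-late {B} {i} {j} i≤j inv with B i ≺? B j
    ... | yes Bi≺Bj = contradiction Bi≺Bj (IsMaxAt⇒⊀ (Inserting.max-here inv i≤j) j)
    ... | no _ = record
      { sorted    = sorted
      ; max-left  = λ 1+j<i → contradiction (≤-trans i≤j (n≤1+n _)) (<⇒≱ 1+j<i)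
      ; max-here  = λ _ → max-here i≤j
      ; dominates = λ k _ k<i → max-here i≤j k (Fin.<⇒≢ k<i)
      }
      where open Inserting inv

    inserting-early-swap : ∀ {B i j} → toℕ j < toℕ i → B i ≺ B j → Inserting B i (toℕ j) →
      Inserting (swapAt O B i j) i (suc (toℕ j))
    inserting-early-swap {B} {i} {j} j<i Bi≺Bj inv = record
      { sorted = sorted′ ; max-left = max-left′ ; max-here = max-here′ ; dominates = dominates′ }
      where
      open Inserting inv
      B′ = swapAt O B i j
      B′i : B′ i ≡ B j
      B′i = swapAt-atˡ B i j
      B′j : B′ j ≡ B i
      B′j = swapAt-atʳ B (Fin.<⇒≢ j<i)
      B′k : ∀ {k} → toℕ k < toℕ i → k ≢ j → B′ k ≡ B k
      B′k k<i k≢j = swapAt-other B (Fin.<⇒≢ k<i) k≢j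

      sorted′ : ∀ p q → toℕ p < toℕ q → toℕ q < toℕ i → B′ p ≺ B′ q
      sorted′ p q p<q q<i with p ≟ j | q ≟ j
      ... | yes refl | yes refl = contradiction p<q (<-irrefl refl)
      ... | yes refl | no q≢j  =
        subst₂ _≺_ (sym B′j) (sym (B′k q<i q≢j)) (≺-trans Bi≺Bj (sorted p q p<q q<i))
      ... | no p≢j  | yes refl =
        subst₂ _≺_ (sym (B′k (<-trans p<q q<i) p≢j)) (sym B′j) (dominates p p<q (<-trans p<q q<i))
      ... | no p≢j  | no q≢j  =
        subst₂ _≺_ (sym (B′k (<-trans p<q q<i) p≢j)) (sym (B′k q<i q≢j)) (sorted p q p<q q<i)

      max-left′ : suc (toℕ j) < toℕ i → ∀ p → suc (toℕ p) ≡ toℕ i → IsMaxAt B′ p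
      max-left′ 1+j<i p 1+p≡i =
        IsMaxAt-swapAt (subst (IsMaxAt B) (sym (transpose-other p≢i p≢j)) (max-left j<i p 1+p≡i))
        where
        p≢i : p ≢ i
        p≢i refl = <-irrefl (sym 1+p≡i) (n<1+n _)
        p≢j : p ≢ j
        p≢j refl = <-irrefl 1+p≡i 1+j<i

      max-here′ : toℕ i ≤ suc (toℕ j) → IsMaxAt B′ i
      max-here′ i≤1+j =
        IsMaxAt-swapAt (subst (IsMaxAt B) (sym (transpose-matchˡ i j)) (max-left j<i j (≤-antisym j<i i≤1+j)))

      dominates′ : ∀ k → toℕ k < suc (toℕ j) → toℕ k < toℕ i → B′ k ≺ B′ i
      dominates′ k k<1+j k<i with k ≟ j
      ... | yes refl = subst₂ _≺_ (sym B′j) (sym B′i) Bi≺Bj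
      ... | no k≢j   =
        subst₂ _≺_ (sym (B′k k<i k≢j)) (sym B′i) (≺-trans (dominates k (<1+∧≢⇒< k<1+j k≢j) k<i) Bi≺Bj)

    inserting-early-keep : ∀ {B i j} → Distinct O B → toℕ j < toℕ i → ¬ B i ≺ B j →
      Inserting B i (toℕ j) → Inserting B i (suc (toℕ j))
    inserting-early-keep {B} {i} {j} distinct j<i Bi⊀Bj inv = record
      { sorted    = sorted
      ; max-left  = λ _ → max-left j<i
      ; max-here  = λ i≤1+j →
          contradiction (max-left j<i j (≤-antisym j<i i≤1+j) i (Fin.<⇒≢ j<i ∘ sym)) Bi⊀Bj
      ; dominates = dominates′
      }
      where
      open Inserting inv
      dominates′ : ∀ k → toℕ k < suc (toℕ j) → toℕ k < toℕ i → B k ≺ B i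
      dominates′ k k<1+j k<i with k ≟ j
      ... | yes refl = ≮∧≉⇒≻ Bi⊀Bj (λ Bi≈Bj → Fin.<⇒≢ j<i (sym (distinct i j Bi≈Bj)))
      ... | no k≢j   = dominates k (<1+∧≢⇒< k<1+j k≢j) k<i

    inserting-step : ∀ {B i j} → Distinct O B → Inserting B i (toℕ j) →
      Inserting (step O B (i , j)) i (suc (toℕ j))
    inserting-step {B} {i} {j} distinct inv with toℕ j <? toℕ i
    ... | no j≮i  = inserting-late (≮⇒≥ j≮i) inv
    ... | yes j<i with B i ≺? B j
    ...   | yes Bi≺Bj = inserting-early-swap j<i Bi≺Bj inv
    ...   | no Bi⊀Bj  = inserting-early-keep distinct j<i Bi⊀Bj inv

    insertion-swap : ∀ {B i j} → Inserting B i (toℕ j) → B i ≺ B j →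
      inversions O B ≡ suc (inversions O (swapAt O B i j))
    insertion-swap {B} {i} {j} inv Bi≺Bj = begin
      #B                            ≡⟨ +-identityʳ #B ⟨
      #B + 0                        ≡⟨ cong (#B +_) (𝟙-no (toℕ i <? toℕ j) (<-asym j<i)) ⟨
      #B + 𝟙[ toℕ i <? toℕ j ]      ≡⟨ inversions-swapAt B Bi≺Bj gap ⟨
      #B′ + 𝟙[ toℕ j <? toℕ i ]     ≡⟨ cong (#B′ +_) (𝟙-yes (toℕ j <? toℕ i) j<i) ⟩
      #B′ + 1                       ≡⟨ +-comm #B′ 1 ⟩
      suc #B′                       ∎
      where
      open ≡-Reasoning
      open Inserting inv
      #B = inversions O B
      #B′ = inversions O (swapAt O B i j)
      j<i : toℕ j < toℕ i
      j<i with toℕ j <? toℕ i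
      ... | yes j<i = j<i
      ... | no j≮i  = contradiction Bi≺Bj (IsMaxAt⇒⊀ (max-here (≮⇒≥ j≮i)) j)
      gap : ∀ k → StrictlyBetween (toℕ i) (toℕ k) (toℕ j) → B k ≺ B i ⊎ B j ≺ B k
      gap k (inj₁ (i<k , k<j)) = contradiction (<-trans i<k k<j) (<-asym j<i)
      gap k (inj₂ (j<k , k<i)) = inj₂ (sorted j k j<k k<i)

  Selecting : ∀ {m} → Array O (suc m) → ℕ → Set ℓ₂
  Selecting B J = ∀ k → 0 < toℕ k → toℕ k < J → B k ≺ B zero

  selecting-step : ∀ {m} {B : Array O (suc m)} j → Distinct O B → Selecting B (toℕ j) →
    Selecting (step O B (zero , j)) (suc (toℕ j))
  selecting-step {B = B} j distinct sel k 0<k k<1+j with B zero ≺? B j | k ≟ j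
  ... | yes B0≺Bj | yes refl = subst (_≺ B k) (sym (swapAt-atʳ B (Fin.<⇒≢ 0<k ∘ sym))) B0≺Bj
  ... | yes B0≺Bj | no k≢j   =
    subst (_≺ B j) (sym (swapAt-other B (Fin.<⇒≢ 0<k ∘ sym) k≢j))
      (≺-trans (sel k 0<k (<1+∧≢⇒< k<1+j k≢j)) B0≺Bj)
  ... | no B0⊀Bj  | yes refl = ≮∧≉⇒≻ B0⊀Bj (λ B0≈Bk → Fin.<⇒≢ 0<k (distinct zero k B0≈Bk))
  ... | no _      | no k≢j   = sel k 0<k (<1+∧≢⇒< k<1+j k≢j)

  selection-swap : ∀ {m} {B : Array O (suc m)} {j} → Selecting B (toℕ j) → B zero ≺ B j →
    inversions O (swapAt O B zero j) ≡ suc (inversions O B)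
  selection-swap {B = B} {j} sel B0≺Bj = begin
    #B′                           ≡⟨ +-identityʳ #B′ ⟨
    #B′ + 0                       ≡⟨ cong (#B′ +_) (𝟙-no (toℕ j <? 0) n≮0) ⟨
    #B′ + 𝟙[ toℕ j <? 0 ]         ≡⟨ inversions-swapAt B B0≺Bj gap ⟩
    #B + 𝟙[ 0 <? toℕ j ]          ≡⟨ cong (#B +_) (𝟙-yes (0 <? toℕ j) (0<j j B0≺Bj)) ⟩
    #B + 1                        ≡⟨ +-comm #B 1 ⟩
    suc #B                        ∎
    where
    open ≡-Reasoning
    #B = inversions O B
    #B′ = inversions O (swapAt O B zero j)
    0<j : ∀ j → B zero ≺ B j → 0 < toℕ j
    0<j zero    B0≺B0 = contradiction B0≺B0 (irrefl Eq.refl)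
    0<j (suc _) _     = s≤s z≤n
    gap : ∀ k → StrictlyBetween 0 (toℕ k) (toℕ j) → B k ≺ B zero ⊎ B j ≺ B k
    gap k (inj₁ (0<k , k<j)) = inj₁ (sel k 0<k k<j)
    gap k (inj₂ (_ , k<0))   = contradiction k<0 n≮0

  module _ {n : ℕ} where

    PhaseInvariant : Array O n → Fin n → ℕ → Set ℓ₂
    PhaseInvariant B zero      J = Selecting B J
    PhaseInvariant B i@(suc _) J = Inserting B i J

    Invariant : Array O n → Fin n → ℕ → Set (ℓ₁ ⊔ ℓ₂)
    Invariant B i J = Distinct O B × PhaseInvariant B i J

    invariant-step : ∀ {B : Array O n} i j → Invariant B i (toℕ j) → Invariant (step O B (i , j)) i (suc (toℕ j))
    invariant-step zero    j (distinct , sel) = step-distinct (zero , j) distinct , selecting-step j distinct sel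
    invariant-step (suc i) j (distinct , ins) = step-distinct (suc i , j) distinct , inserting-step distinct ins

    row-start : ∀ {B : Array O n} {i i′ : Fin n} → toℕ i′ ≡ suc (toℕ i) →
      (∀ p q → toℕ p < toℕ q → toℕ q ≤ toℕ i → B p ≺ B q) → IsMaxAt B i → Inserting B i′ 0
    row-start {B} i′≡1+i sorted max = record
      { sorted    = λ p q p<q q<i′ → sorted p q p<q (m<1+n⇒m≤n (subst (toℕ q <_) i′≡1+i q<i′))
      ; max-left  = λ _ p 1+p≡i′ →
          subst (IsMaxAt B) (Fin.toℕ-injective (suc-injective (trans (sym i′≡1+i) (sym 1+p≡i′)))) max
      ; max-here  = λ i′≤0 → contradiction (subst (_≤ 0) i′≡1+i i′≤0) λ ()
      ; dominates = λ k k<0 → contradiction k<0 n≮0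
      }

    next-row : ∀ {B : Array O n} {i i′ : Fin n} → toℕ i′ ≡ suc (toℕ i) →
      PhaseInvariant B i n → PhaseInvariant B i′ 0
    next-row {i′ = zero} ()
    next-row {B} {zero} {suc _} i′≡1 sel =
      row-start i′≡1 (λ p q p<q q≤0 → contradiction (<-≤-trans p<q q≤0) n≮0) max
      where
      max : IsMaxAt B zero
      max zero    0≢0 = contradiction refl 0≢0
      max (suc k) _   = sel (suc k) (s≤s z≤n) (Fin.toℕ<n (suc k))
    next-row {B} {i@(suc _)} {suc _} i′≡1+i ins =
      row-start i′≡1+i sorted′ (max-here (<⇒≤ (Fin.toℕ<n i)))
      where
      open Inserting ins
      sorted′ : ∀ p q → toℕ p < toℕ q → toℕ q ≤ toℕ i → B p ≺ B q
      sorted′ p q p<q q≤i with q ≟ i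
      ... | yes refl = dominates p (<-trans p<q (Fin.toℕ<n q)) p<q
      ... | no q≢i   = sorted p q p<q (Fin.≤∧≢⇒< q≤i q≢i)

  module _ {n : ℕ} {ℓ : Level} (Q : Fin n × Fin n → Array O n → Set ℓ) where

    BeforeEachStep : List (Fin n × Fin n) → Array O n → Set ℓ
    BeforeEachStep []       B = ⊤
    BeforeEachStep (x ∷ xs) B = Q x B × BeforeEachStep xs (step O B x)

    BeforeEachStep-++ : ∀ xs {ys B} → BeforeEachStep xs B → BeforeEachStep ys (run O xs B) →
      BeforeEachStep (xs ++ ys) B
    BeforeEachStep-++ []       _                holds-ys = holds-ys
    BeforeEachStep-++ (x ∷ xs) (qx , holds-xs) holds-ys = qx , BeforeEachStep-++ xs holds-xs holds-ys

    BeforeEachStep-at : ∀ {xs B} pre {y} post → BeforeEachStep xs B → xs ≡ pre ++ y ∷ post → Q y (run O pre B)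
    BeforeEachStep-at []        _    (qy , _)       refl = qy
    BeforeEachStep-at (_ ∷ pre) post (_ , holds-xs) refl = BeforeEachStep-at pre post holds-xs refl

  module _ {n : ℕ} where

    InvariantBefore : Fin n × Fin n → Array O n → Set (ℓ₁ ⊔ ℓ₂)
    InvariantBefore (i , j) B = Invariant B i (toℕ j)

    row : Fin n → List (Fin n × Fin n)
    row i = map (i ,_) (allFin n)

    along-row : ∀ {m} {B : Array O n} i c (g : Fin m → Fin n) → (∀ k → toℕ (g k) ≡ c + toℕ k) →
      Invariant B i c →
      BeforeEachStep InvariantBefore (map (i ,_) (tabulate g)) B
        × Invariant (run O (map (i ,_) (tabulate g)) B) i (c + m)
    along-row {zero}      i c g _  inv = tt , subst (Invariant _ i) (sym (+-identityʳ c)) inv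
    along-row {suc m} {B} i c g g≡ inv =
      (before , proj₁ rest) , subst (Invariant _ i) (sym (+-suc c m)) (proj₂ rest)
      where
      g₀≡c : toℕ (g zero) ≡ c
      g₀≡c = trans (g≡ zero) (+-identityʳ c)
      before : Invariant B i (toℕ (g zero))
      before = subst (Invariant B i) (sym g₀≡c) inv
      rest = along-row i (suc c) (g ∘ suc) (λ k → trans (g≡ (suc k)) (+-suc c (toℕ k)))
               (subst (Invariant _ i) (cong suc g₀≡c) (invariant-step i (g zero) before))

    along-rows : ∀ {m} {B : Array O n} d (h : Fin m → Fin n) → (∀ k → toℕ (h k) ≡ d + toℕ k) →
      (∀ r → toℕ r ≡ d → Invariant B r 0) → BeforeEachStep InvariantBefore (concatMap row (tabulate h)) B
    along-rows {zero}      _ _ _  _     = tt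
    along-rows {suc m} {B} d h h≡ start =
      BeforeEachStep-++ InvariantBefore (row (h zero)) (proj₁ this-row)
        (along-rows (suc d) (h ∘ suc) (λ k → trans (h≡ (suc k)) (+-suc d (toℕ k))) next)
      where
      h₀≡d : toℕ (h zero) ≡ d
      h₀≡d = trans (h≡ zero) (+-identityʳ d)
      this-row = along-row (h zero) 0 (λ k → k) (λ _ → refl) (start (h zero) h₀≡d)
      next : ∀ r → toℕ r ≡ suc d → Invariant (run O (row (h zero)) B) r 0
      next r r≡1+d =
        proj₁ (proj₂ this-row) , next-row (trans r≡1+d (cong suc (sym h₀≡d))) (proj₂ (proj₂ this-row))

    along-schedule : ∀ {B : Array O n} → Distinct O B → BeforeEachStep InvariantBefore (schedule n) B
    along-schedule {B} distinct = along-rows 0 (λ k → k) (λ _ → refl) start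
      where
      start : ∀ r → toℕ r ≡ 0 → Invariant B r 0
      start zero    _ = distinct , λ _ _ ()
      start (suc _) ()

    swap-effect : ∀ {B : Array O n} i j → Invariant B i (toℕ j) → B i ≺ B j →
      (toℕ i ≡ 0 → inversions O (swapAt O B i j) ≡ suc (inversions O B))
      × (¬ toℕ i ≡ 0 → inversions O B ≡ suc (inversions O (swapAt O B i j)))
    swap-effect zero    j (_ , sel) B0≺Bj = (λ _ → selection-swap sel B0≺Bj) , (λ 0≢0 → contradiction refl 0≢0)
    swap-effect (suc i) j (_ , ins) Bi≺Bj = (λ ())                             , (λ _ → insertion-swap ins Bi≺Bj)

mainTheorem2 : ∀ {a ℓ₁ ℓ₂ : Level} (O : StrictTotalOrder a ℓ₁ ℓ₂) (n : ℕ) → 1 ≤ n →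
    (A : Array O n) → Distinct O A →
    ∀ (pre : List (Fin n × Fin n)) (i j : Fin n) (post : List (Fin n × Fin n)) →
    schedule n ≡ pre ++ (i , j) ∷ post →
    StrictTotalOrder._<_ O (run O pre A i) (run O pre A j) →
    (toℕ i ≡ 0 →
       inversions O (swapAt O (run O pre A) i j) ≡ suc (inversions O (run O pre A)))
    × (¬ toℕ i ≡ 0 →
       inversions O (run O pre A) ≡ suc (inversions O (swapAt O (run O pre A) i j)))
mainTheorem2 O n _ A distinct pre i j post split =
  swap-effect O i j (BeforeEachStep-at O (InvariantBefore O) pre post (along-schedule O distinct) split)
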